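{- Let $G$ be a finite undirected graph without self-loops whose nodes carry labels from a finite alphabet $\Gamma$ and data values from $\mathbb{N}$. Suppose that for each $a\in\Gamma$ we have $|\mathrm{Val}_G(a)|\ge \deg(G)|\Gamma|+\deg(G)+1$. Then the data values on the nodes of $G$ can be reassigned to obtain a data graph $G'$ with $V(G')=V(G)$ and $E(G')=E(G)$ such that: (1) $\mathrm{lab}_{G'}(u)=\mathrm{lab}_G(u)$ for each node $u$; (2) $\mathrm{Val}_{G'}(a)=\mathrm{Val}_G(a)$ for each $a\in\Gamma$; (3) for all nodes $u,v$, if $(u,v)\in E(G')$ then $\mathrm{val}_{G'}(u)\neq\mathrm{val}_{G'}(v)$.
   Context: For a data graph $G$, $\mathrm{lab}_G(u)\in\Gamma$ and $\mathrm{val}_G(u)\in\mathbb{N}$ denote the label and data value of node $u$; $\mathrm{Val}_G(a)$ is the set of data values found in $a$-nodes (nodes labelled $a$); $\deg(G)$ is the maximum degree of a node of $G$. -}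

module Defs where

open import Data.Nat using (ℕ; zero; suc; _+_; _*_; _⊔_; _≟_)
open import Data.Bool using (Bool; true; false; T)
open import Data.Fin using (Fin)
open import Data.Fin.Properties as FinP using ()
open import Data.List using (List; length; filter; map; foldr; deduplicate)
open import Data.List.Membership.Propositional using (_∈_)
open import Data.List.Relation.Unary.Unique.Propositional using (Unique)
open import Data.Vec.Functional using ()
open import Data.Fin.Base using ()
open import Data.List.Base using ()
open import Relation.Nullary using (¬_)
open import Relation.Binary.PropositionalEquality using (_≡_)
open import Data.Bool.Properties using (T?)
open import Data.List using (allFin)

-- A finite data graph: nodes are Fin n, labels from a finite alphabet Γ = Fin k,
-- data values in ℕ, undirected edges without self-loops given by a Boolean
-- adjacency relation.
record DataGraph (n k : ℕ) : Set where
  field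
    edge : Fin n → Fin n → Bool
    sym  : ∀ u v → edge u v ≡ edge v u
    loopless : ∀ u → edge u u ≡ false
    lab  : Fin n → Fin k
    val  : Fin n → ℕ
open DataGraph public

nodes : (n : ℕ) → List (Fin n)
nodes n = allFin n

neighbours : ∀ {n k} → DataGraph n k → Fin n → List (Fin n)
neighbours {n} G u = filter (λ v → T? (edge G u v)) (nodes n)

degree : ∀ {n k} → DataGraph n k → Fin n → ℕ
degree G u = length (neighbours G u)

maxDeg : ∀ {n k} → DataGraph n k → ℕ
maxDeg {n} G = foldr (λ u m → degree G u ⊔ m) 0 (nodes n)

nodesWith : ∀ {n k} → DataGraph n k → Fin k → List (Fin n)
nodesWith {n} G a = filter (λ u → lab G u FinP.≟ a) (nodes n)

Val : ∀ {n k} → DataGraph n k → Fin k → List ℕ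
Val G a = deduplicate _≟_ (map (val G) (nodesWith G a))

∣Val∣ : ∀ {n k} → DataGraph n k → Fin k → ℕ
∣Val∣ G a = length (Val G a)

reassign : ∀ {n k} → DataGraph n k → (Fin n → ℕ) → DataGraph n k
reassign G f = record
  { edge = edge G ; sym = sym G ; loopless = loopless G ; lab = lab G ; val = f }

-- Fix one canonical node for every pair (label, value) occurring in G.  Permuting
-- values among canonical nodes of equal label leaves every Val(a) unchanged, so the
-- canonical nodes are made properly coloured one at a time by transpositions: u is
-- swapped with a canonical node w of its label that is not blocked, i.e. w neither
-- carries the value of a neighbour of u nor is adjacent to a node carrying the value
-- of u.  At most deg(G) + |Γ| deg(G) nodes are blocked, fewer than the canonical
-- nodes of any label.  Every other node of label a then greedily takes a value of
-- Val(a) unused by its at most deg(G) neighbours.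
module Submission where

open import Defs
open import Data.Bool using (Bool; T)
open import Data.Bool.Properties using (T?; T-≡)
open import Data.Empty using (⊥-elim)
open import Data.Fin using (Fin)
open import Data.Fin.Permutation as Perm using (Permutation′; _⟨$⟩ʳ_; _⟨$⟩ˡ_; _∘ₚ_; inverseˡ; inverseʳ)
open import Data.Fin.Permutation.Components using (transpose)
import Data.Fin.Properties as Fin
open import Data.List using (List; []; _∷_; length; map; filter; concatMap; allFin; fromMaybe; find; foldr; _++_)
open import Data.List.Properties using (length-map; length-++; length-tabulate; filter-notAll)
open import Data.List.Membership.Propositional using (_∈_; _∉_; lose)
import Data.List.Membership.Propositional as Membership
open import Data.List.Membership.Propositional.Properties
  using ( ∈-filter⁺; ∈-filter⁻; ∈-map⁺; ∈-map⁻; ∈-concatMap⁺; ∈-deduplicate⁺; ∈-deduplicate⁻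
        ; ∈-allFin; ∈-++⁺ˡ; ∈-++⁺ʳ)
import Data.List.Membership.DecPropositional as DecMembership
open import Data.List.Relation.Unary.All as All using (all?)
open import Data.List.Relation.Unary.All.Properties.Core using (¬All⇒Any¬)
open import Data.List.Relation.Unary.Any as Any using (here; there)
open import Data.List.Relation.Unary.AllPairs using (_∷_)
open import Data.List.Relation.Unary.Unique.Propositional using (Unique)
open import Data.List.Relation.Unary.Unique.Propositional.Properties using (allFin⁺; filter⁺)
open import Data.List.Relation.Unary.Unique.DecPropositional.Properties using (deduplicate-!)
open import Data.Maybe using (Maybe; just; nothing)
open import Data.Maybe.Properties using (just-injective)
import Data.Maybe.Properties as Maybe
open import Data.Nat using (ℕ; suc; _+_; _*_; _≤_; _<_; _⊔_; z≤n; s≤s; z<s)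
import Data.Nat as ℕ
open import Data.Nat.Properties
open import Data.Product using (Σ; _×_; _,_; proj₁; proj₂; ∃-syntax)
open import Data.Sum using (_⊎_; inj₁; inj₂)
open import Data.Vec.Functional using (updateAt)
open import Data.Vec.Functional.Properties using (updateAt-updates; updateAt-minimal)
open import Function using (_∘_; const; id)
open import Function.Bundles using (_⇔_; Equivalence; mk⇔)
open import Relation.Nullary using (¬_; yes; no; ¬?; contradiction)
open import Relation.Nullary.Decidable using (⌊_⌋; _×-dec_; toWitness; fromWitness)
open import Relation.Unary using (Decidable)
open import Relation.Binary.Definitions using (DecidableEquality)
open import Relation.Binary.PropositionalEquality using (_≡_; _≢_; refl; trans; cong; cong₂; subst; ≢-sym)
import Relation.Binary.PropositionalEquality as ≡

module _ {A : Set} (_≟_ : DecidableEquality A) where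
  open DecMembership _≟_ using (_∈?_)

  Unique-⊆⇒length≤ : ∀ {xs ys : List A} → Unique xs → (∀ {x} → x ∈ xs → x ∈ ys) →
                     length xs ≤ length ys
  Unique-⊆⇒length≤ {[]} _ _ = z≤n
  Unique-⊆⇒length≤ {x ∷ xs} {ys} (x∉xs ∷ xs!) xs⊆ys = begin
    suc (length xs)    ≤⟨ s≤s (Unique-⊆⇒length≤ xs! xs⊆ys-x) ⟩
    suc (length ys-x)  ≤⟨ filter-notAll (λ y → ¬? (x ≟ y)) ys
                            (Any.map (λ x≡y x≢y → x≢y x≡y) (xs⊆ys (here refl))) ⟩
    length ys          ∎
    where
    open ≤-Reasoning
    ys-x : List A
    ys-x = filter (λ y → ¬? (x ≟ y)) ys
    xs⊆ys-x : ∀ {z} → z ∈ xs → z ∈ ys-x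
    xs⊆ys-x z∈xs = ∈-filter⁺ (λ y → ¬? (x ≟ y)) (xs⊆ys (there z∈xs)) (All.lookup x∉xs z∈xs)

  unique-pigeonhole : ∀ {xs ys : List A} → Unique xs → length ys < length xs →
                      ∃[ x ] x ∈ xs × x ∉ ys
  unique-pigeonhole {xs} {ys} xs! ys<xs with all? (_∈? ys) xs
  ... | yes xs⊆ys = contradiction (Unique-⊆⇒length≤ xs! (All.lookup xs⊆ys)) (<⇒≱ ys<xs)
  ... | no  xs⊈ys = Membership.find (¬All⇒Any¬ (_∈? ys) xs xs⊈ys)

module _ {A : Set} {P : A → Set} (P? : Decidable P) where

  find-sound : ∀ xs {c} → find P? xs ≡ just c → P c
  find-sound (x ∷ xs) eq with P? x
  ... | yes px = subst P (just-injective eq) px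
  ... | no  _  = find-sound xs eq

  find-complete : ∀ {xs x} → x ∈ xs → P x → ∃[ c ] find P? xs ≡ just c
  find-complete {y ∷ xs} x∈ px with P? y | x∈
  ... | yes _   | _         = y , refl
  ... | no  ¬py | here refl = contradiction px ¬py
  ... | no  _   | there x∈xs = find-complete x∈xs px

length-concatMap-≤ : ∀ {A B : Set} (g : A → List B) {c} → (∀ x → length (g x) ≤ c) →
                     ∀ xs → length (concatMap g xs) ≤ length xs * c
length-concatMap-≤ g g≤c []       = z≤n
length-concatMap-≤ g g≤c (x ∷ xs) = begin
  length (g x ++ concatMap g xs)          ≡⟨ length-++ (g x) ⟩
  length (g x) + length (concatMap g xs)  ≤⟨ +-mono-≤ (g≤c x) (length-concatMap-≤ g g≤c xs) ⟩
  _ + length xs * _                       ∎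
  where open ≤-Reasoning

≤-foldr-⊔ : ∀ {A : Set} (g : A → ℕ) {x} xs → x ∈ xs → g x ≤ foldr (λ y m → g y ⊔ m) 0 xs
≤-foldr-⊔ g (x ∷ xs) (here refl) = m≤m⊔n (g x) _
≤-foldr-⊔ g (y ∷ xs) (there x∈) = ≤-trans (≤-foldr-⊔ g xs x∈) (m≤n⊔m (g y) _)

data TransposeView {n} (i j k : Fin n) : Fin n → Set where
  at-i      : k ≡ i → TransposeView i j k j
  at-j      : k ≢ i → k ≡ j → TransposeView i j k i
  elsewhere : k ≢ i → k ≢ j → TransposeView i j k k

transpose-view : ∀ {n} (i j k : Fin n) → TransposeView i j k (transpose i j k)
transpose-view i j k with k Fin.≟ i
... | yes k≡i = at-i k≡i
... | no  k≢i with k Fin.≟ j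
...   | yes k≡j = at-j k≢i k≡j
...   | no  k≢j = elsewhere k≢i k≢j

module _ {n : ℕ} {A : Set} where

  Preserves : (Fin n → A) → Permutation′ n → Set
  Preserves g σ = ∀ z → g (σ ⟨$⟩ʳ z) ≡ g z

  transpose-preserves : ∀ (g : Fin n → A) {i j} → g i ≡ g j → Preserves g (Perm.transpose i j)
  transpose-preserves g {i} {j} gi≡gj z with transpose i j z | transpose-view i j z
  ... | _ | at-i z≡i = trans (≡.sym gi≡gj) (cong g (≡.sym z≡i))
  ... | _ | at-j _ z≡j = trans gi≡gj (cong g (≡.sym z≡j))
  ... | _ | elsewhere _ _ = refl

  ∘ₚ-preserves : ∀ {g : Fin n → A} π ρ → Preserves g π → Preserves g ρ → Preserves g (π ∘ₚ ρ)
  ∘ₚ-preserves π ρ π-pres ρ-pres z = trans (ρ-pres (π ⟨$⟩ʳ z)) (π-pres z)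

  preserves⁻¹ : ∀ {g : Fin n → A} σ → Preserves g σ → ∀ z → g (σ ⟨$⟩ˡ z) ≡ g z
  preserves⁻¹ {g} σ σ-pres z = trans (≡.sym (σ-pres (σ ⟨$⟩ˡ z))) (cong g (inverseʳ σ))

module _ {n k : ℕ} (H : DataGraph n k) where

  ∈-Val⁻ : ∀ a {x} → x ∈ Val H a → ∃[ z ] lab H z ≡ a × val H z ≡ x
  ∈-Val⁻ a x∈ with ∈-map⁻ (val H) (∈-deduplicate⁻ ℕ._≟_ (map (val H) (nodesWith H a)) x∈)
  ... | z , z∈ , x≡ = z , proj₂ (∈-filter⁻ (λ u → lab H u Fin.≟ a) {xs = allFin n} z∈) , ≡.sym x≡

  Val-unique : ∀ a → Unique (Val H a)
  Val-unique a = deduplicate-! ℕ._≟_ (map (val H) (nodesWith H a))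

  ∈-Val⁺ : ∀ {a x} z → lab H z ≡ a → val H z ≡ x → x ∈ Val H a
  ∈-Val⁺ {a} z refl refl =
    ∈-deduplicate⁺ ℕ._≟_ (∈-map⁺ (val H) (∈-filter⁺ (λ u → lab H u Fin.≟ a) (∈-allFin z) refl))

module _ {n k : ℕ} (G : DataGraph n k) where

  Adj : Fin n → Fin n → Set
  Adj u v = T (edge G u v)

  adj-sym : ∀ {u v} → Adj u v → Adj v u
  adj-sym {u} {v} = subst T (DataGraph.sym G u v)

  adj-irrefl : ∀ {u} → ¬ Adj u u
  adj-irrefl {u} = subst T (loopless G u)

  adj⇒∈-neighbours : ∀ {u v} → Adj u v → v ∈ neighbours G u
  adj⇒∈-neighbours {u} = ∈-filter⁺ (λ w → T? (edge G u w)) (∈-allFin _)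

  degree≤maxDeg : ∀ u → degree G u ≤ maxDeg G
  degree≤maxDeg u = ≤-foldr-⊔ (degree G) (allFin n) (∈-allFin u)

  ProperOn : (Fin n → Set) → (Fin n → ℕ) → Set
  ProperOn D f = ∀ u v → D u → D v → Adj u v → f u ≢ f v

  Proper : (Fin n → ℕ) → Set
  Proper f = ∀ u v → Adj u v → f u ≢ f v

  ProperOn-mono : ∀ {D D′ f} → (∀ {z} → D′ z → D z) → ProperOn D f → ProperOn D′ f
  ProperOn-mono D′⊆D proper u v u∈ v∈ = proper u v (D′⊆D u∈) (D′⊆D v∈)

  private
    domain : ∀ (D : Fin n → Set) {u z} → D z ⊎ z ≡ u → z ≢ u → D z
    domain D (inj₁ z∈D) _   = z∈D
    domain D (inj₂ z≡u) z≢u = contradiction z≡u z≢u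

  adj⇒≢ : ∀ {u v} → Adj u v → v ≢ u
  adj⇒≢ u~v refl = adj-irrefl u~v

  recolour-fresh : ∀ {f : Fin n → ℕ} {u y q} → y ∉ map f (neighbours G u) → Adj u q →
                   updateAt f u (const y) u ≢ updateAt f u (const y) q
  recolour-fresh {f} {u} {y} {q} y-fresh u~q eq =
    y-fresh (subst (_∈ map f (neighbours G u)) fq≡y (∈-map⁺ f (adj⇒∈-neighbours u~q)))
    where
    open ≡.≡-Reasoning
    fq≡y : f q ≡ y
    fq≡y = begin
      f q                       ≡⟨ ≡.sym (updateAt-minimal q u f (adj⇒≢ u~q)) ⟩
      updateAt f u (const y) q  ≡⟨ ≡.sym eq ⟩
      updateAt f u (const y) u  ≡⟨ updateAt-updates u f ⟩
      y                         ∎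

  recolour-proper : ∀ {D f u y} → ProperOn D f → y ∉ map f (neighbours G u) →
                    ProperOn (λ z → D z ⊎ z ≡ u) (updateAt f u (const y))
  recolour-proper {D} {f} {u} {y} f-proper y-fresh p q p∈ q∈ p~q with p Fin.≟ u | q Fin.≟ u
  ... | yes refl | yes refl = ⊥-elim (adj-irrefl p~q)
  ... | yes refl | no  _   = recolour-fresh y-fresh p~q
  ... | no  _    | yes refl = ≢-sym (recolour-fresh y-fresh (adj-sym p~q))
  ... | no  p≢u  | no  q≢u = λ eq →
    f-proper p q (domain D p∈ p≢u) (domain D q∈ q≢u) p~q (begin
    f p                         ≡⟨ ≡.sym (updateAt-minimal p u f p≢u) ⟩
    updateAt f u (const y) p    ≡⟨ eq ⟩
    updateAt f u (const y) q    ≡⟨ updateAt-minimal q u f q≢u ⟩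
    f q                         ∎)
    where open ≡.≡-Reasoning

  transpose-proper : ∀ {D f u w} → ProperOn D f →
                     (∀ v → Adj u v → f v ≢ f w) →
                     (∀ z → D z → Adj w z → f z ≢ f u) →
                     ProperOn (λ z → D z ⊎ z ≡ u) (f ∘ transpose u w)
  transpose-proper {D} {f} {u} {w} f-proper u-free w-free p q p∈ q∈ p~q
    with transpose u w p | transpose-view u w p | transpose u w q | transpose-view u w q
  ... | _ | at-i refl         | _ | at-i refl         = ⊥-elim (adj-irrefl p~q)
  ... | _ | at-i refl         | _ | at-j _ refl       = ⊥-elim (u-free w p~q refl)
  ... | _ | at-i refl         | _ | elsewhere _ _     = ≢-sym (u-free q p~q)
  ... | _ | at-j _ refl       | _ | at-i refl         = ⊥-elim (u-free w (adj-sym p~q) refl)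
  ... | _ | at-j _ refl       | _ | at-j _ refl       = ⊥-elim (adj-irrefl p~q)
  ... | _ | at-j _ refl       | _ | elsewhere q≢u _   = ≢-sym (w-free q (domain D q∈ q≢u) p~q)
  ... | _ | elsewhere _ _     | _ | at-i refl         = u-free p (adj-sym p~q)
  ... | _ | elsewhere p≢u _   | _ | at-j _ refl       = w-free p (domain D p∈ p≢u) (adj-sym p~q)
  ... | _ | elsewhere p≢u _   | _ | elsewhere q≢u _   =
    f-proper p q (domain D p∈ p≢u) (domain D q∈ q≢u) p~q

  module _ {R : Fin n → Set} (R? : Decidable R) (P : Fin n → List ℕ)
           (P-unique : ∀ u → Unique (P u)) (degree<∣P∣ : ∀ u → degree G u < length (P u))
           {f : Fin n → ℕ} (f-proper : ProperOn R f) where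

    Extension : (Fin n → Set) → (Fin n → ℕ) → Set
    Extension D g = (∀ z → R z → g z ≡ f z)
                  × (∀ z → ¬ R z → D z → g z ∈ P z)
                  × ProperOn (λ z → R z ⊎ D z) g

    extension-∷ : ∀ {xs g} u → Extension (_∈ xs) g → ∃[ g′ ] Extension (_∈ u ∷ xs) g′
    extension-∷ {xs} {g} u (agree , palette , proper) with R? u
    ... | yes Ru = g , agree , palette′ , ProperOn-mono domain′ proper
      where
      palette′ : ∀ z → ¬ R z → z ∈ u ∷ xs → g z ∈ P z
      palette′ z ¬Rz (here refl) = contradiction Ru ¬Rz
      palette′ z ¬Rz (there z∈) = palette z ¬Rz z∈
      domain′ : ∀ {z} → R z ⊎ z ∈ u ∷ xs → R z ⊎ z ∈ xs
      domain′ (inj₁ Rz)          = inj₁ Rz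
      domain′ (inj₂ (here refl)) = inj₁ Ru
      domain′ (inj₂ (there z∈))  = inj₂ z∈
    ... | no ¬Ru with unique-pigeonhole ℕ._≟_ (P-unique u)
                        (subst (_< length (P u)) (≡.sym (length-map g (neighbours G u))) (degree<∣P∣ u))
    ...   | y , y∈P , y-fresh = g′ , agree′ , palette′ , ProperOn-mono domain′ (recolour-proper proper y-fresh)
      where
      g′ : Fin n → ℕ
      g′ = updateAt g u (const y)
      agree′ : ∀ z → R z → g′ z ≡ f z
      agree′ z Rz = trans (updateAt-minimal z u g (λ { refl → ¬Ru Rz })) (agree z Rz)
      palette′ : ∀ z → ¬ R z → z ∈ u ∷ xs → g′ z ∈ P z
      palette′ z ¬Rz z∈ with z Fin.≟ u | z∈
      ... | yes refl | _          = subst (_∈ P u) (≡.sym (updateAt-updates u {const y} g)) y∈P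
      ... | no  z≢u  | here z≡u   = contradiction z≡u z≢u
      ... | no  z≢u  | there z∈xs = subst (_∈ P z) (≡.sym (updateAt-minimal z u g z≢u)) (palette z ¬Rz z∈xs)
      domain′ : ∀ {z} → R z ⊎ z ∈ u ∷ xs → (R z ⊎ z ∈ xs) ⊎ z ≡ u
      domain′ (inj₁ Rz)          = inj₁ (inj₁ Rz)
      domain′ (inj₂ (here refl)) = inj₂ refl
      domain′ (inj₂ (there z∈))  = inj₁ (inj₂ z∈)

    extension : ∀ xs → ∃[ g ] Extension (_∈ xs) g
    extension []       = f , (λ _ _ → refl) , (λ _ _ ()) , ProperOn-mono (λ { (inj₁ Rz) → Rz }) f-proper
    extension (u ∷ xs) = extension-∷ u (proj₂ (extension xs))

    greedy-extension : ∃[ g ] (∀ z → R z → g z ≡ f z) × (∀ z → ¬ R z → g z ∈ P z) × Proper g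
    greedy-extension with extension (allFin n)
    ... | g , agree , palette , proper =
      g , agree , (λ z ¬Rz → palette z ¬Rz (∈-allFin z)) ,
      λ u v → proper u v (inj₂ (∈-allFin u)) (inj₂ (∈-allFin v))

length-fromMaybe : ∀ {A : Set} (m : Maybe A) → length (fromMaybe m) ≤ 1
length-fromMaybe (just _) = s≤s z≤n
length-fromMaybe nothing  = z≤n

nodesWithIn : ∀ {n k} → DataGraph n k → (Fin n → Bool) → Fin k → List (Fin n)
nodesWithIn {n} G R a = filter (λ z → T? (R z) ×-dec (lab G z Fin.≟ a)) (allFin n)

module _ {n k} (G : DataGraph n k) (R : Fin n → Bool) where

  ∈-nodesWithIn⁺ : ∀ {a z} → T (R z) → lab G z ≡ a → z ∈ nodesWithIn G R a
  ∈-nodesWithIn⁺ {a} {z} Rz lz = ∈-filter⁺ (λ z → T? (R z) ×-dec (lab G z Fin.≟ a)) (∈-allFin z) (Rz , lz)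

  ∈-nodesWithIn⁻ : ∀ {a z} → z ∈ nodesWithIn G R a → T (R z) × lab G z ≡ a
  ∈-nodesWithIn⁻ {a} z∈ = proj₂ (∈-filter⁻ (λ z → T? (R z) ×-dec (lab G z Fin.≟ a)) {xs = allFin n} z∈)

module Swapping {n k} (G : DataGraph n k) (R : Fin n → Bool)
  (R-injective : ∀ {r s} → T (R r) → T (R s) → lab G r ≡ lab G s → val G r ≡ val G s → r ≡ s)
  (R-large : ∀ a → maxDeg G * k + maxDeg G + 1 ≤ length (nodesWithIn G R a)) where

  permutedValues : Permutation′ n → Fin n → ℕ
  permutedValues σ z = val G (σ ⟨$⟩ʳ z)

  Admissible : Permutation′ n → Set
  Admissible σ = Preserves (lab G) σ × Preserves R σ

  private
    Carries : Fin k → ℕ → Fin n → Set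
    Carries b x z = T (R z) × lab G z ≡ b × val G z ≡ x

    carries? : ∀ b x → Decidable (Carries b x)
    carries? b x z = T? (R z) ×-dec (lab G z Fin.≟ b ×-dec val G z ℕ.≟ x)

    carrier : Fin k → ℕ → List (Fin n)
    carrier b x = fromMaybe (find (carries? b x) (allFin n))

    carrier-complete : ∀ {b x z} → Carries b x z → z ∈ carrier b x
    carrier-complete {b} {x} {z} z-carries@(Rz , lz , vz)
      with find-complete (carries? b x) (∈-allFin z) z-carries
    ... | c , found with find-sound (carries? b x) (allFin n) found
    ...   | Rc , lc , vc = subst (λ m → z ∈ fromMaybe m) (≡.sym found)
                             (here (R-injective Rz Rc (trans lz (≡.sym lc)) (trans vz (≡.sym vc))))

  -- the R-node of label b that receives the value x under σ, if any
  holder : Permutation′ n → Fin k → ℕ → List (Fin n)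
  holder σ b x = map (σ ⟨$⟩ˡ_) (carrier b x)

  length-holder : ∀ σ b x → length (holder σ b x) ≤ 1
  length-holder σ b x = begin
    length (holder σ b x)  ≡⟨ length-map (σ ⟨$⟩ˡ_) (carrier b x) ⟩
    length (carrier b x)   ≤⟨ length-fromMaybe (find (carries? b x) (allFin n)) ⟩
    1                      ∎
    where open ≤-Reasoning

  holder-complete : ∀ σ → Admissible σ → ∀ {z b x} → T (R z) → lab G z ≡ b →
                    permutedValues σ z ≡ x → z ∈ holder σ b x
  holder-complete σ (lab-pres , R-pres) {z} Rz refl σz-value =
    subst (_∈ holder σ _ _) (inverseˡ σ)
      (∈-map⁺ (σ ⟨$⟩ˡ_) (carrier-complete (subst T (≡.sym (R-pres z)) Rz , lab-pres z , σz-value)))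

  holdersOfNeighbourValues : Permutation′ n → Fin n → List (Fin n)
  holdersOfNeighbourValues σ u =
    concatMap (λ v → holder σ (lab G u) (permutedValues σ v)) (neighbours G u)

  neighboursOfHolders : Permutation′ n → Fin n → List (Fin n)
  neighboursOfHolders σ u =
    concatMap (λ b → concatMap (neighbours G) (holder σ b (permutedValues σ u))) (allFin k)

  blocked : Permutation′ n → Fin n → List (Fin n)
  blocked σ u = holdersOfNeighbourValues σ u ++ neighboursOfHolders σ u

  holder-of-neighbour-value-blocked :
    ∀ σ → Admissible σ → ∀ {u v w} → T (R w) → lab G w ≡ lab G u → Adj G u v →
    permutedValues σ w ≡ permutedValues σ v → w ∈ blocked σ u
  holder-of-neighbour-value-blocked σ σ-adm {u} Rw lw u~v σw≡σv =
    ∈-++⁺ˡ (∈-concatMap⁺ (λ v → holder σ (lab G u) (permutedValues σ v))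
             (lose (adj⇒∈-neighbours G u~v) (holder-complete σ σ-adm Rw lw σw≡σv)))

  neighbour-of-holder-blocked :
    ∀ σ → Admissible σ → ∀ {u w z} → T (R z) → Adj G w z →
    permutedValues σ z ≡ permutedValues σ u → w ∈ blocked σ u
  neighbour-of-holder-blocked σ σ-adm {u} {w} {z} Rz w~z σz≡σu =
    ∈-++⁺ʳ (holdersOfNeighbourValues σ u)
      (∈-concatMap⁺ (λ b → concatMap (neighbours G) (holder σ b (permutedValues σ u)))
        (lose (∈-allFin (lab G z))
          (∈-concatMap⁺ (neighbours G)
            (lose (holder-complete σ σ-adm Rz refl σz≡σu) (adj⇒∈-neighbours G (adj-sym G w~z))))))

  length-blocked : ∀ σ u → length (blocked σ u) ≤ maxDeg G * k + maxDeg G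
  length-blocked σ u = begin
    length (blocked σ u)
      ≡⟨ length-++ (holdersOfNeighbourValues σ u) ⟩
    length (holdersOfNeighbourValues σ u) + length (neighboursOfHolders σ u)
      ≤⟨ +-mono-≤ near far ⟩
    maxDeg G * 1 + length (allFin k) * (1 * maxDeg G)
      ≡⟨ cong₂ _+_ (*-identityʳ (maxDeg G))
                   (cong₂ _*_ (length-tabulate {n = k} id) (*-identityˡ (maxDeg G))) ⟩
    maxDeg G + k * maxDeg G
      ≡⟨ trans (+-comm (maxDeg G) (k * maxDeg G)) (cong (_+ maxDeg G) (*-comm k (maxDeg G))) ⟩
    maxDeg G * k + maxDeg G
      ∎
    where
    open ≤-Reasoning
    near : length (holdersOfNeighbourValues σ u) ≤ maxDeg G * 1
    near = ≤-trans (length-concatMap-≤ _ (length-holder σ (lab G u) ∘ permutedValues σ) (neighbours G u))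
                   (*-monoˡ-≤ 1 (degree≤maxDeg G u))
    neighboursOfHolder≤ : ∀ b →
      length (concatMap (neighbours G) (holder σ b (permutedValues σ u))) ≤ 1 * maxDeg G
    neighboursOfHolder≤ b =
      ≤-trans (length-concatMap-≤ (neighbours G) (degree≤maxDeg G) (holder σ b (permutedValues σ u)))
              (*-monoˡ-≤ (maxDeg G) (length-holder σ b (permutedValues σ u)))
    far : length (neighboursOfHolders σ u) ≤ length (allFin k) * (1 * maxDeg G)
    far = length-concatMap-≤ _ neighboursOfHolder≤ (allFin k)

  transpose-admissible : ∀ σ {u w} → Admissible σ → T (R u) → T (R w) → lab G u ≡ lab G w →
                         Admissible (Perm.transpose u w ∘ₚ σ)
  transpose-admissible σ {u} {w} (lab-pres , R-pres) Ru Rw lu≡lw =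
    ∘ₚ-preserves (Perm.transpose u w) σ (transpose-preserves (lab G) lu≡lw) lab-pres ,
    ∘ₚ-preserves (Perm.transpose u w) σ (transpose-preserves R Ru≡Rw) R-pres
    where
    Ru≡Rw : R u ≡ R w
    Ru≡Rw = trans (Equivalence.to T-≡ Ru) (≡.sym (Equivalence.to T-≡ Rw))

  swap-step : ∀ {D} → (∀ {z} → D z → T (R z)) → ∀ σ → Admissible σ →
              ProperOn G D (permutedValues σ) → ∀ {u} → T (R u) →
              ∃[ σ′ ] Admissible σ′ × ProperOn G (λ z → D z ⊎ z ≡ u) (permutedValues σ′)
  swap-step D⊆R σ σ-adm proper {u} Ru
    with unique-pigeonhole Fin._≟_ (filter⁺ _ (allFin⁺ n)) unblocked-exists
    where
    unblocked-exists : length (blocked σ u) < length (nodesWithIn G R (lab G u))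
    unblocked-exists =
      ≤-trans (s≤s (length-blocked σ u)) (≤-trans (≤-reflexive (+-comm 1 _)) (R-large (lab G u)))
  ... | w , w∈ , w∉ with ∈-nodesWithIn⁻ G R w∈
  ...   | Rw , lw =
    Perm.transpose u w ∘ₚ σ ,
    transpose-admissible σ σ-adm Ru Rw (≡.sym lw) ,
    transpose-proper G proper
      (λ v u~v σv≡σw → w∉ (holder-of-neighbour-value-blocked σ σ-adm Rw lw u~v (≡.sym σv≡σw)))
      (λ z Dz w~z σz≡σu → w∉ (neighbour-of-holder-blocked σ σ-adm (D⊆R Dz) w~z σz≡σu))

  properOn-prefix : ∀ xs → ∃[ σ ] Admissible σ × ProperOn G (λ z → T (R z) × z ∈ xs) (permutedValues σ)
  properOn-prefix [] = Perm.id , ((λ _ → refl) , (λ _ → refl)) , λ { _ _ (_ , ()) }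
  properOn-prefix (u ∷ xs) with properOn-prefix xs | T? (R u)
  ... | σ , σ-adm , proper | no ¬Ru = σ , σ-adm , ProperOn-mono G domain′ proper
    where
    domain′ : ∀ {z} → T (R z) × z ∈ u ∷ xs → T (R z) × z ∈ xs
    domain′ (Rz , here refl) = contradiction Rz ¬Ru
    domain′ (Rz , there z∈) = Rz , z∈
  ... | σ , σ-adm , proper | yes Ru with swap-step proj₁ σ σ-adm proper Ru
  ...   | σ′ , σ′-adm , proper′ = σ′ , σ′-adm , ProperOn-mono G domain′ proper′
    where
    domain′ : ∀ {z} → T (R z) × z ∈ u ∷ xs → (T (R z) × z ∈ xs) ⊎ z ≡ u
    domain′ (_  , here refl) = inj₂ refl
    domain′ (Rz , there z∈) = inj₁ (Rz , z∈)

  properOn-R : ∃[ σ ] Admissible σ × ProperOn G (T ∘ R) (permutedValues σ)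
  properOn-R with properOn-prefix (allFin n)
  ... | σ , σ-adm , proper = σ , σ-adm , ProperOn-mono G (λ Rz → Rz , ∈-allFin _) proper

module _ {n k : ℕ} (G : DataGraph n k) where

  private
    matches? : ∀ a x → Decidable (λ z → lab G z ≡ a × val G z ≡ x)
    matches? a x z = lab G z Fin.≟ a ×-dec val G z ℕ.≟ x

  canonical : Fin k → ℕ → Maybe (Fin n)
  canonical a x = find (matches? a x) (allFin n)

  isCanonical : Fin n → Bool
  isCanonical z = ⌊ Maybe.≡-dec Fin._≟_ (canonical (lab G z) (val G z)) (just z) ⌋

  canonical⇒isCanonical : ∀ {a x c} → canonical a x ≡ just c → T (isCanonical c)
  canonical⇒isCanonical {a} {x} found with find-sound (matches? a x) (allFin n) found
  ... | refl , refl = fromWitness found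

  isCanonical-injective : ∀ {r s} → T (isCanonical r) → T (isCanonical s) →
                          lab G r ≡ lab G s → val G r ≡ val G s → r ≡ s
  isCanonical-injective Cr Cs lr≡ls vr≡vs =
    just-injective (trans (≡.sym (toWitness Cr)) (trans (cong₂ canonical lr≡ls vr≡vs) (toWitness Cs)))

  canonical-witness : ∀ {a x} → x ∈ Val G a → ∃[ c ] T (isCanonical c) × lab G c ≡ a × val G c ≡ x
  canonical-witness {a} {x} x∈ with ∈-Val⁻ G a x∈
  ... | z , lz , vz with find-complete (matches? a x) (∈-allFin z) (lz , vz)
  ...   | c , found = c , canonical⇒isCanonical found , find-sound (matches? a x) (allFin n) found

  ∣Val∣≤∣canonical∣ : ∀ a → ∣Val∣ G a ≤ length (nodesWithIn G isCanonical a)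
  ∣Val∣≤∣canonical∣ a = begin
    length (Val G a)
      ≤⟨ Unique-⊆⇒length≤ ℕ._≟_ (Val-unique G a) Val⊆ ⟩
    length (map (val G) (nodesWithIn G isCanonical a))
      ≡⟨ length-map (val G) (nodesWithIn G isCanonical a) ⟩
    length (nodesWithIn G isCanonical a)
      ∎
    where
    open ≤-Reasoning
    Val⊆ : ∀ {x} → x ∈ Val G a → x ∈ map (val G) (nodesWithIn G isCanonical a)
    Val⊆ x∈ with canonical-witness x∈
    ... | c , Cc , lc , refl =
      ∈-map⁺ (val G) (∈-nodesWithIn⁺ G isCanonical Cc lc)

  degree<∣Val∣ : (∀ a → maxDeg G * k + maxDeg G + 1 ≤ ∣Val∣ G a) →
                 ∀ u → degree G u < ∣Val∣ G (lab G u)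
  degree<∣Val∣ large u = begin-strict
    degree G u                    ≤⟨ degree≤maxDeg G u ⟩
    maxDeg G                      ≤⟨ m≤n+m (maxDeg G) (maxDeg G * k) ⟩
    maxDeg G * k + maxDeg G       <⟨ m<m+n _ z<s ⟩
    maxDeg G * k + maxDeg G + 1   ≤⟨ large (lab G u) ⟩
    ∣Val∣ G (lab G u)             ∎
    where open ≤-Reasoning

lemma4p1 : ∀ {n k} (G : DataGraph n k) →
    (∀ (a : Fin k) → maxDeg G * k + maxDeg G + 1 ≤ ∣Val∣ G a) →
    Σ (Fin n → ℕ) λ f →
      let G′ = reassign G f in
        (∀ (u : Fin n) → lab G′ u ≡ lab G u)
        × (∀ (a : Fin k) (x : ℕ) → (x ∈ Val G′ a) ⇔ (x ∈ Val G a))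
        × (∀ (u v : Fin n) → T (edge G′ u v) → val G′ u ≢ val G′ v)
lemma4p1 G large
  with Swapping.properOn-R G (isCanonical G) (isCanonical-injective G)
         (λ a → ≤-trans (large a) (∣Val∣≤∣canonical∣ G a))
... | σ , (lab-pres , R-pres) , σ-proper
  with greedy-extension G (T? ∘ isCanonical G) (λ u → Val G (lab G u))
         (Val-unique G ∘ lab G) (degree<∣Val∣ G large) σ-proper
... | g , agree , palette , proper = g , (λ _ → refl) , (λ a x → mk⇔ (values-kept a) (values-covered a)) , proper
  where
  values-kept : ∀ a {x} → x ∈ Val (reassign G g) a → x ∈ Val G a
  values-kept a x∈ with ∈-Val⁻ (reassign G g) a x∈
  ... | z , refl , refl with T? (isCanonical G z)
  ...   | yes Cz = ∈-Val⁺ G (σ ⟨$⟩ʳ z) (lab-pres z) (≡.sym (agree z Cz))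
  ...   | no ¬Cz = palette z ¬Cz
  values-covered : ∀ a {x} → x ∈ Val G a → x ∈ Val (reassign G g) a
  values-covered a x∈ with canonical-witness G x∈
  ... | c , Cc , refl , refl =
    ∈-Val⁺ (reassign G g) (σ ⟨$⟩ˡ c) (preserves⁻¹ σ lab-pres c)
      (trans (agree _ (subst T (≡.sym (preserves⁻¹ σ R-pres c)) Cc)) (cong (val G) (inverseʳ σ)))
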